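{- Let $J$ be a core join-calculus process. Then its Petri net semantics $N(J)$ is 1-safe, i.e. every marking reachable from the initial marking puts at most one token on each place.
   Context: Names: an infinite set $\mathcal N$. Core join processes are generated by $P ::= 0 \mid x\langle v\rangle \mid P \,|\, P \mid \mathsf{def}\ x\langle u\rangle | y\langle v\rangle \triangleright P \ \mathsf{in}\ P$ with $x,y,u,v \in \mathcal N$. A join definition is $D = x\langle u\rangle | y\langle v\rangle \triangleright R$; $\mathcal D$ is the set of join definitions; $\mathrm{dv}(D) = \{x,y\}$. Stacks over $\mathcal D$: either empty $\bot$ or $[e,s']$ with $e\in\mathcal D$, $s'$ a stack; $\mathcal S_{\mathcal D}$ is the set of stacks. $s\top$ is $e$ if $s=[e,s']$ and $\varepsilon$ if $s=\bot$; $s\,\mathrm{push}\,e=[e,s]$; $s\,\mathrm{pop}$ is $s'$ if $s=[e,s']$ and $\bot$ if $s=\bot$. Convention: $\mathrm{dv}(\varepsilon)$ contains every name. Places: universe $\mathcal P = \{x\langle v\rangle \mid x,v\in\mathcal N\}\times\mathcal S_{\mathcal D}\times\mathcal S_{\mathcal D}$. For $f:\mathcal N\to\mathcal N\times\mathcal S_{\mathcal D}$ write $f=(f^1,f^2)$; $f_\bot(n)=(n,\bot)$; $g_n(f)(n)=(f^1(n), f^2(n)\,\mathrm{pop})$ and $g_n(f)(m)=f(m)$ for $m\ne n$. Decomposition $dec(P,f)$ (a finite multiset of places; distinct occurrences are distinct places, equality up to isomorphism): $dec(0,f)=\emptyset$; $dec(P|Q,f)=dec(P,f)\uplus dec(Q,f)$;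 $dec(\mathsf{def}\ D\ \mathsf{in}\ P,f)=dec(P,(\mathrm{id}\times\mathrm{push}\,D)\circ f)$; $dec(x\langle v\rangle,f)$ is $dec(x\langle v\rangle,g_x(f))$ if $f^1(x)\notin\mathrm{dv}(f^2(x)\top)$, else $dec(x\langle v\rangle,g_v(f))$ if $f^1(v)\notin\mathrm{dv}(f^2(v)\top)$, otherwise the single place $(f^1(x)\langle f^1(v)\rangle,f^2(x),f^2(v))$. Petri nets: a labeled net $(P,T)$ has $P\subseteq\mathcal P$, $T\subseteq 2^P\times\mathcal D\times 2^P$; for $t=(A,D,B)$: $\bullet t=A$, $t\bullet=B$, $l(t)=D$; $\bullet p=\{t\mid p\in t\bullet\}$; $\bullet P'=\bigcup_{p\in P'}\bullet p$. A Petri net $(P,T,m_0)$ has initial marking $m_0$ (multiset over $P$). A transition $t$ is enabled under marking $m$ iff $m(p)>0$ for all $p\in\bullet t$; firing gives $m'$ with $m'(p)=m(p)+1$ for $p\in t\bullet\setminus\bullet t$, $m'(p)=m(p)-1$ for $p\in\bullet t\setminus t\bullet$, $m'(p)=m(p)$ otherwise. Reachable markings are those obtained from $m_0$ by finitely many firings. Transition rule: $(P,T,m_0)$ satisfies it iff for every two places $p=(x\langle a\rangle,s,s_a)$, $q=(y\langle b\rangle,s,s_b)$ in $P$ with $s\top=x\langle u\rangle|y\langle v\rangle\triangleright R$ there is $t=(\{p,q\},x\langle u\rangle|y\langle v\rangle\triangleright R,P')\in T$ with $P'=dec(R,f_t)$, $P'\cap m_0=\emptyset$, $\bullet P'=\{t\}$,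 where $f_t(u)=(a,s_a)$, $f_t(v)=(b,s_b)$, $f_t(n)=(n,s)$ otherwise. $N(J)=(P,T,m_0)$ is the smallest Petri net with $m_0=dec(J,f_\bot)\subseteq P$ satisfying the transition rule. -}

module Defs where

open import Data.Nat using (ℕ; zero; suc; _≤_; _<_; _∸_; _≡ᵇ_)
open import Data.Bool using (Bool; true; false; if_then_else_; _∨_)
open import Data.List using (List; []; _∷_; _++_; length; lookup)
open import Data.Fin using (Fin; toℕ)
open import Data.Product using (_×_; _,_; proj₁; proj₂; Σ; Σ-syntax)
open import Data.Sum using (_⊎_)
open import Data.Empty using (⊥)
open import Relation.Nullary using (¬_)
open import Relation.Binary.PropositionalEquality using (_≡_)

-- Names: we take 𝒩 = ℕ (an infinite set with decidable equality).

Name : Set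
Name = ℕ

mutual
  -- join definitions  D = x⟨u⟩ | y⟨v⟩ ▷ R
  record JDef : Set where
    inductive
    constructor jdef
    field
      x u y v : Name
      body    : Proc

  data Proc : Set where
    nil  : Proc
    msg  : Name → Name → Proc
    par  : Proc → Proc → Proc
    defn : JDef → Proc → Proc

open JDef public

-- Stacks over 𝒟 (⊥ = [], [e , s'] = e ∷ s')

Stack : Set
Stack = List JDef

push : JDef → Stack → Stack
push e s = e ∷ s

-- n ∈ dv(s⊤), with the convention dv(ε) = all names.
inDvTop : Name → Stack → Bool
inDvTop n []      = true
inDvTop n (e ∷ s) = (n ≡ᵇ x e) ∨ (n ≡ᵇ y e)

-- pop the stack until the name is defined by its top
-- (this is the iterated application of g_n in the output case of dec)
resolve : Name → Stack → Stack
resolve n []      = []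
resolve n (e ∷ s) = if inDvTop n (e ∷ s) then e ∷ s else resolve n s

record PlaceLabel : Set where
  constructor place
  field
    chan  : Name
    arg   : Name
    stk   : Stack
    stkA  : Stack

open PlaceLabel public

Env : Set
Env = Name → Name × Stack

f⊥ : Env
f⊥ n = (n , [])

pushEnv : JDef → Env → Env
pushEnv D f n = (proj₁ (f n) , push D (proj₂ (f n)))

decOut : Env → Name → Name → PlaceLabel
decOut f a b =
  place (proj₁ (f a)) (proj₁ (f b))
        (resolve (proj₁ (f a)) (proj₂ (f a)))
        (resolve (proj₁ (f b)) (proj₂ (f b)))

-- dec(P, f), a finite multiset (list of occurrences) of places
dec : Proc → Env → List PlaceLabel
dec nil        f = []
dec (msg a b)  f = decOut f a b ∷ []
dec (par P Q)  f = dec P f ++ dec Q f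
dec (defn D P) f = dec P (pushEnv D f)

-- f_t for a transition with definition D on stack s, consuming x⟨a⟩
-- (with v-stack sa) and y⟨b⟩ (with v-stack sb)
fT : JDef → Stack → Name → Stack → Name → Stack → Env
fT D s a sa b sb n =
  if n ≡ᵇ u D then (a , sa) else if n ≡ᵇ v D then (b , sb) else (n , s)

-- The Petri net N(J): places are occurrences (initial ones, and fresh
-- post-places of each transition); transitions are exactly those
-- demanded by the transition rule (this is the smallest such net).

module Net (J : Proc) where

  m0L : List PlaceLabel
  m0L = dec J f⊥

  -- Identity of an occurrence: its generation history (which initial
  -- occurrence, or which post-occurrence of the transition consuming
  -- which two places).  Used to express distinctness of the two places
  -- consumed by a transition while keeping the definition strictly positive.
  data Code : Set where
    leaf : ℕ → Code
    node : Code → Code → ℕ → Code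

  mutual
    data Pl : Set where
      init : Fin (length m0L) → Pl
      out  : (t : Tr) → Fin (length (postL t)) → Pl

    data Tr : Set where
      tr : (p q : Pl) → .(¬ (code p ≡ code q)) → (D : JDef) (s : Stack) →
           stk (lab p) ≡ D ∷ s → stk (lab q) ≡ D ∷ s →
           chan (lab p) ≡ x D → chan (lab q) ≡ y D → Tr

    code : Pl → Code
    code (init i) = leaf (toℕ i)
    code (out (tr p q _ _ _ _ _ _ _) k) = node (code p) (code q) (toℕ k)

    lab : Pl → PlaceLabel
    lab (init i)  = lookup m0L i
    lab (out t k) = lookup (postL t) k

    postL : Tr → List PlaceLabel
    postL (tr p q _ D s _ _ _ _) =
      dec (body D) (fT D (D ∷ s) (arg (lab p)) (stkA (lab p))
                                 (arg (lab q)) (stkA (lab q)))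

  InPre : Tr → Pl → Set
  InPre (tr p q _ _ _ _ _ _ _) r = r ≡ p ⊎ r ≡ q

  InPost : Tr → Pl → Set
  InPost t r = Σ[ k ∈ Fin (length (postL t)) ] r ≡ out t k

  label : Tr → JDef
  label (tr _ _ _ D _ _ _ _ _) = D

  Marking : Set
  Marking = Pl → ℕ

  m0 : Marking
  m0 (init _)  = 1
  m0 (out _ _) = 0

  Enabled : Marking → Tr → Set
  Enabled m t = ∀ r → InPre t r → 0 < m r

  Fires : Marking → Tr → Marking → Set
  Fires m t m' = ∀ r →
      (InPost t r → ¬ InPre t r → m' r ≡ suc (m r))
    × (InPre t r → ¬ InPost t r → m' r ≡ m r ∸ 1)
    × (¬ ((InPost t r × ¬ InPre t r) ⊎ (InPre t r × ¬ InPost t r)) → m' r ≡ m r)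

  data Reachable : Marking → Set where
    base : Reachable m0
    step : ∀ {m m'} → Reachable m → (t : Tr) → Enabled m t → Fires m t m' →
           Reachable m'

  OneSafe : Set
  OneSafe = ∀ m → Reachable m → ∀ r → m r ≤ 1

module Submission where

-- Every place of N(J) has a single producer: an initial place is produced by
-- the initial marking, the place  out t k  only by the transition t.  Along a
-- firing sequence, indexed by the set of transitions that have fired so far,
-- the current marking satisfies an invariant of four facts:
--   * every place holds at most one token,
--   * a place that has not been produced yet is empty,
--   * the pre-places of a transition that has fired are empty,
--   * the pre-places of a transition that has fired had been produced.
-- The key consequence is that an enabled transition has not fired yet (its
-- pre-places would be empty), so its post-places are still unproduced, hence
-- empty, and firing it puts exactly one token on each of them.

open import Defs
open import Data.Nat using (ℕ; suc; _≤_; _<_; _∸_; z≤n; s≤s)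
open import Data.Nat.Properties using (_≟_; _≤?_; m∸n≤m; ≤-trans)
open import Data.Product using (_×_; _,_; proj₁; proj₂; Σ)
open import Data.Sum using (_⊎_; inj₁; inj₂)
open import Data.Empty using (⊥; ⊥-elim)
open import Data.Unit using (⊤; tt)
open import Relation.Nullary using (¬_; yes; no)
open import Relation.Unary using (Decidable)
open import Relation.Binary.PropositionalEquality using (_≡_; refl; sym; subst)

≤1⇒∸1≡0 : ∀ {n} → n ≤ 1 → n ∸ 1 ≡ 0
≤1⇒∸1≡0 z≤n       = refl
≤1⇒∸1≡0 (s≤s z≤n) = refl

empty-not-positive : ∀ {n} → n ≡ 0 → ¬ (0 < n)
empty-not-positive refl ()

module OneSafety (J : Proc) where
  open Net J

  Untouched : Tr → Pl → Set
  Untouched t r = ¬ ((InPost t r × ¬ InPre t r) ⊎ (InPre t r × ¬ InPost t r))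

  -- The firing relation fixes m' r only through the negated case distinction
  -- Untouched, so without decidable equality of places we can only conclude
  -- decidable properties of m' r, by checking them in each of the three cases.
  fires-elim : ∀ {m t m'} → Fires m t m' → ∀ r →
    (Q : ℕ → Set) → Decidable Q →
    (InPost t r → ¬ InPre t r → Q (suc (m r))) →
    (InPre t r → ¬ InPost t r → Q (m r ∸ 1)) →
    (Untouched t r → Q (m r)) →
    Q (m' r)
  fires-elim {t = t} {m'} F r Q Q? added removed kept with Q? (m' r)
  ... | yes q = q
  ... | no ¬q = ⊥-elim (¬q (subst Q (sym (proj₂ (proj₂ (F r)) untouched)) (kept untouched)))
    where
    untouched : Untouched t r
    untouched (inj₁ (post , ¬pre)) =
      ¬q (subst Q (sym (proj₁ (F r) post ¬pre)) (added post ¬pre))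
    untouched (inj₂ (pre , ¬post)) =
      ¬q (subst Q (sym (proj₁ (proj₂ (F r)) pre ¬post)) (removed pre ¬post))

  fires-bounded : ∀ {m t m'} → Fires m t m' → (∀ r → m r ≤ 1) →
    (∀ r → InPost t r → m r ≡ 0) → ∀ r → m' r ≤ 1
  fires-bounded {m} F bounded postEmpty r =
    fires-elim F r (λ n → n ≤ 1) (_≤? 1)
      (λ post _ → subst (λ n → suc n ≤ 1) (sym (postEmpty r post)) (s≤s z≤n))
      (λ _ _ → ≤-trans (m∸n≤m (m r) 1) (bounded r))
      (λ _ → bounded r)

  fires-keeps-empty : ∀ {m t m'} → Fires m t m' → ∀ r →
    ¬ InPost t r → m r ≡ 0 → m' r ≡ 0
  fires-keeps-empty F r ¬post empty =
    fires-elim F r (λ n → n ≡ 0) (_≟ 0)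
      (λ post _ → ⊥-elim (¬post post))
      (λ _ _ → subst (λ n → n ∸ 1 ≡ 0) (sym empty) refl)
      (λ _ → empty)

  fires-drains : ∀ {m t m'} → Fires m t m' → ∀ r →
    InPre t r → ¬ InPost t r → m r ≤ 1 → m' r ≡ 0
  fires-drains F r pre ¬post bounded =
    fires-elim F r (λ n → n ≡ 0) (_≟ 0)
      (λ _ ¬pre → ⊥-elim (¬pre pre))
      (λ _ _ → ≤1⇒∸1≡0 bounded)
      (λ untouched → ⊥-elim (untouched (inj₂ (pre , ¬post))))

  Produced : (Tr → Set) → Pl → Set
  Produced Fired (init _)  = ⊤
  Produced Fired (out t _) = Fired t

  produced-mono : ∀ {Fired Fired'} → (∀ t → Fired t → Fired' t) →
    ∀ r → Produced Fired r → Produced Fired' r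
  produced-mono sub (init _)  tt    = tt
  produced-mono sub (out t _) fired = sub t fired

  record Invariant (m : Marking) (Fired : Tr → Set) : Set where
    field
      bounded            : ∀ r → m r ≤ 1
      unproduced-empty   : ∀ r → ¬ Produced Fired r → m r ≡ 0
      fired-drained      : ∀ t → Fired t → ∀ r → InPre t r → m r ≡ 0
      fired-pre-produced : ∀ t → Fired t → ∀ r → InPre t r → ¬ ¬ Produced Fired r

  NoneFired : Tr → Set
  NoneFired _ = ⊥

  invariant-m0 : Invariant m0 NoneFired
  invariant-m0 = record
    { bounded            = bounded
    ; unproduced-empty   = unproduced-empty
    ; fired-drained      = λ _ ()
    ; fired-pre-produced = λ _ ()
    }
    where
    bounded : ∀ r → m0 r ≤ 1
    bounded (init _)  = s≤s z≤n
    bounded (out _ _) = z≤n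

    unproduced-empty : ∀ r → ¬ Produced NoneFired r → m0 r ≡ 0
    unproduced-empty (init _)  unproduced = ⊥-elim (unproduced tt)
    unproduced-empty (out _ _) _          = refl

  some-pre : (t : Tr) → Σ Pl (InPre t)
  some-pre (tr p _ _ _ _ _ _ _ _) = p , inj₁ refl

  Fired+ : (Tr → Set) → Tr → Tr → Set
  Fired+ Fired t t₀ = Fired t₀ ⊎ t₀ ≡ t

  module Step {m m' Fired t} (I : Invariant m Fired)
              (enabled : Enabled m t) (F : Fires m t m') where
    open Invariant I

    -- An enabled transition has not fired yet: its pre-places would be empty.
    not-fired : ¬ Fired t
    not-fired fired =
      empty-not-positive (fired-drained t fired p pre) (enabled p pre)
      where
      p   = proj₁ (some-pre t)
      pre = proj₂ (some-pre t)

    -- Hence the post-places of t are unproduced, so empty, and disjoint from •t.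
    post-unproduced : ∀ r → InPost t r → ¬ Produced Fired r
    post-unproduced _ (_ , refl) = not-fired

    post-empty : ∀ r → InPost t r → m r ≡ 0
    post-empty r post = unproduced-empty r (post-unproduced r post)

    pre-not-post : ∀ r → InPre t r → ¬ InPost t r
    pre-not-post r pre post = empty-not-positive (post-empty r post) (enabled r pre)

    Fired' : Tr → Set
    Fired' = Fired+ Fired t

    produced-later : ∀ r → Produced Fired r → Produced Fired' r
    produced-later = produced-mono (λ _ → inj₁)

    post-produced : ∀ r → InPost t r → Produced Fired' r
    post-produced _ (_ , refl) = inj₂ refl

    unproduced-empty' : ∀ r → ¬ Produced Fired' r → m' r ≡ 0
    unproduced-empty' r unproduced =
      fires-keeps-empty F r (λ post → unproduced (post-produced r post))
        (unproduced-empty r (λ produced → unproduced (produced-later r produced)))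

    -- The pre-places of an earlier transition were produced, so they are not
    -- refilled by t; those of t itself are emptied.
    fired-drained' : ∀ t₀ → Fired' t₀ → ∀ r → InPre t₀ r → m' r ≡ 0
    fired-drained' t₀ (inj₁ fired) r pre =
      fires-keeps-empty F r
        (λ post → fired-pre-produced t₀ fired r pre (post-unproduced r post))
        (fired-drained t₀ fired r pre)
    fired-drained' _ (inj₂ refl) r pre =
      fires-drains F r pre (pre-not-post r pre) (bounded r)

    -- The pre-places of t are marked, hence produced.
    fired-pre-produced' : ∀ t₀ → Fired' t₀ → ∀ r → InPre t₀ r → ¬ ¬ Produced Fired' r
    fired-pre-produced' t₀ (inj₁ fired) r pre unproduced =
      fired-pre-produced t₀ fired r pre (λ produced → unproduced (produced-later r produced))
    fired-pre-produced' _ (inj₂ refl) r pre unproduced =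
      empty-not-positive
        (unproduced-empty r (λ produced → unproduced (produced-later r produced)))
        (enabled r pre)

    invariant' : Invariant m' Fired'
    invariant' = record
      { bounded            = fires-bounded F bounded post-empty
      ; unproduced-empty   = unproduced-empty'
      ; fired-drained      = fired-drained'
      ; fired-pre-produced = fired-pre-produced'
      }

  reachable-invariant : ∀ {m} → Reachable m → Σ (Tr → Set) (Invariant m)
  reachable-invariant base = NoneFired , invariant-m0
  reachable-invariant (step R t enabled F) =
    let (Fired , I) = reachable-invariant R
    in Fired+ Fired t , Step.invariant' I enabled F

  one-safe : OneSafe
  one-safe m R = Invariant.bounded (proj₂ (reachable-invariant R))

mainTheorem2 : (J : Proc) → Net.OneSafe J
mainTheorem2 J = OneSafety.one-safe J
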